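{- Let $G$ be a context-free grammar with ownership, $A$ a nondeterministic finite automaton over the terminals of $G$, $\sigma$ the least solution of the system of equations induced by $G$ and $A$, and $\alpha$ a sentential form. Prover has a winning strategy from $\alpha$ in the emptiness game if and only if $\sigma(\alpha)=\mathit{false}$ (i.e. $\sigma(\alpha)$ is logically equivalent to $\mathit{false}$).
   Context: Game: A context-free grammar with ownership is $G=(N_{\bigcirc}\,\dot\cup\,N_{\square},T,P)$ with disjoint finite sets of non-terminals $N=N_{\bigcirc}\cup N_{\square}$ and terminals $T$, and a finite set of rules $X\to\eta$ with $X\in N$, $\eta\in(N\cup T)^*$; every non-terminal is the left-hand side of some rule. Non-terminals in $N_{\bigcirc}$ are owned by the player refuter, those in $N_{\square}$ by the player prover. Sentential forms are the elements of $(N\cup T)^*$. Left derivation: $\alpha\Rightarrow_L\beta$ iff $\alpha=wX\gamma$ with $w\in T^*$, $X\in N$, a rule $X\to\eta$, and $\beta=w\eta\gamma$. A sentential form is owned by prover if its leftmost non-terminal is in $N_\square$, otherwise by refuter (refuter owns terminal words). A play is a finite or infinite sequence of sentential forms $p_0p_1\dots$ with $p_i\Rightarrow_L p_{i+1}$; it is maximal if it is infinite or ends in a terminal word. A strategy for a player maps every non-maximal finite play whose last position is owned by that player to a $\Rightarrow_L$-successor of that position; a play conforms to the strategy if all moves at that player's positions follow it; the strategy is winning from $p_0$ if all maximal plays from $p_0$ conforming to it satisfy the player's winning condition. In the emptiness game, a maximal play is won by prover iff it is infinite (and by refuter iff it is finite). Domain: Let $A=(T,Q,q_0,Q_F,\to)$.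 Boxes are subsets of $Q\times Q$, composed relationally: $\rho;\tau=\{(q,q''):\exists q'.(q,q')\in\rho,(q',q'')\in\tau\}$; $\mathrm{id}=\{(q,q):q\in Q\}$; for $a\in T$, $[a]=\{(q,q'):q\xrightarrow{a}q'\}$. $BF_A$ is the set of negation-free Boolean formulas over boxes (with $\wedge,\vee$ and the constant $\mathit{false}$, where $\mathit{false}\wedge F=F\wedge\mathit{false}=\mathit{false}$ and $\mathit{false}\vee F=F\vee\mathit{false}=F$ are applied syntactically). Relational composition of formulas: $F;\mathit{false}=\mathit{false};G=\mathit{false}$, $(F_1\star F_2);G=(F_1;G)\star(F_2;G)$ and $\rho;(G_1\star G_2)=(\rho;G_1)\star(\rho;G_2)$ for $\star\in\{\wedge,\vee\}$ and boxes $\rho$. Formulas are considered modulo logical equivalence, ordered by implication. The system of equations induced by $G$ and $A$ has one variable $\Delta_X$ per non-terminal; if $X\to\eta_1,\dots,X\to\eta_k$ are all rules for $X$, then $\Delta_X=[\eta_1]\wedge\dots\wedge[\eta_k]$ if $X\in N_\square$ and $\Delta_X=[\eta_1]\vee\dots\vee[\eta_k]$ if $X\in N_\bigcirc$, where $[\varepsilon]=\mathrm{id}$, $[a]$ is the box of $a\in T$, $[Y]=\Delta_Y$, and $[\alpha\beta]=[\alpha];[\beta]$. Its least solution $\sigma$ is the limit of the Kleene iteration starting from $\sigma^0(X)=\mathit{false}$ for all $X$. It is extended to sentential forms by $\sigma(\varepsilon)=\mathrm{id}$, $\sigma(a)=[a]$ for $a\in T$, $\sigma(\alpha\beta)=\sigma(\alpha);\sigma(\beta)$.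 -}

module Defs where

open import Data.Nat using (ℕ; zero; suc; _<_; _≤_)
open import Data.Fin using (Fin; zero; suc; _≟_)
open import Data.Bool using (Bool; true; false; _∧_; _∨_)
open import Data.Vec using (Vec; tabulate; lookup)
open import Data.List using (List; []; _∷_; _++_; map; upTo; filter)
open import Data.List.Membership.Propositional using (_∈_)
open import Data.List.Relation.Unary.Any using (Any)
open import Data.Product using (Σ; _×_; _,_; proj₁; proj₂; ∃)
open import Data.Sum using (_⊎_; inj₁; inj₂)
open import Data.Empty using (⊥)
open import Data.Unit using (⊤)
open import Relation.Binary.PropositionalEquality using (_≡_)
open import Relation.Nullary.Decidable using (does)

data Owner : Set where
  refuter prover : Owner

Symbol : ℕ → ℕ → Set
Symbol nN nT = Fin nT ⊎ Fin nN

record Grammar : Set where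
  field
    nN    : ℕ
    nT    : ℕ
    owner : Fin nN → Owner
    rules : List (Fin nN × List (Symbol nN nT))
    total : (X : Fin nN) → Any (λ r → proj₁ r ≡ X) rules

module _ (G : Grammar) where
  open Grammar G

  SF : Set
  SF = List (Symbol nN nT)

  data _⇒L_ : SF → SF → Set where
    leftStep : (w : List (Fin nT)) (X : Fin nN) (η γ : SF) → (X , η) ∈ rules →
               (map inj₁ w ++ (inj₂ X ∷ γ)) ⇒L (map inj₁ w ++ (η ++ γ))

  ownerOf : SF → Owner
  ownerOf []            = refuter
  ownerOf (inj₁ a ∷ α)  = ownerOf α
  ownerOf (inj₂ X ∷ α)  = owner X

  IsTerminalSym : Symbol nN nT → Set
  IsTerminalSym (inj₁ _) = ⊤
  IsTerminalSym (inj₂ _) = ⊥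

  open import Data.List.Relation.Unary.All using (All)

  IsTerminalWord : SF → Set
  IsTerminalWord α = All IsTerminalSym α

  -- A (prover) strategy: given the history p₀ … pᵢ₋₁ and the current
  -- position pᵢ owned by prover, choose a ⇒L-successor of pᵢ.
  -- (It is given on all finite sequences; only its values on plays matter.)
  record ProverStrategy : Set where
    field
      move  : List SF → SF → SF
      legal : (h : List SF) (p : SF) → ownerOf p ≡ prover → p ⇒L move h p
  open ProverStrategy public

  -- Maximal plays: finite ones f 0 … f n ending in a terminal word,
  -- and infinite ones f 0 f 1 ….
  data MaxPlay : Set where
    finitePlay   : ℕ → (ℕ → SF) → MaxPlay
    infinitePlay : (ℕ → SF) → MaxPlay

  IsMaxPlayFrom : SF → MaxPlay → Set
  IsMaxPlayFrom p₀ (finitePlay n f) =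
    f 0 ≡ p₀ × (∀ i → i < n → f i ⇒L f (suc i)) × IsTerminalWord (f n)
  IsMaxPlayFrom p₀ (infinitePlay f) =
    f 0 ≡ p₀ × (∀ i → f i ⇒L f (suc i))

  ConformsAt : ProverStrategy → (ℕ → SF) → ℕ → Set
  ConformsAt s f i = ownerOf (f i) ≡ prover → f (suc i) ≡ move s (map f (upTo i)) (f i)

  Conforms : ProverStrategy → MaxPlay → Set
  Conforms s (finitePlay n f) = ∀ i → i < n → ConformsAt s f i
  Conforms s (infinitePlay f) = ∀ i → ConformsAt s f i

  WonByProver : MaxPlay → Set
  WonByProver (finitePlay _ _) = ⊥
  WonByProver (infinitePlay _) = ⊤

  IsWinningFrom : ProverStrategy → SF → Set
  IsWinningFrom s p₀ = ∀ π → IsMaxPlayFrom p₀ π → Conforms s π → WonByProver π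

  ProverWinsFrom : SF → Set
  ProverWinsFrom p₀ = Σ ProverStrategy λ s → IsWinningFrom s p₀

record NFA (nT : ℕ) : Set where
  field
    nQ    : ℕ
    q₀    : Fin nQ
    final : Fin nQ → Bool
    trans : Fin nQ → Fin nT → Fin nQ → Bool

anyFin : ∀ {k} → (Fin k → Bool) → Bool
anyFin {zero}  f = false
anyFin {suc k} f = f zero ∨ anyFin (λ i → f (suc i))

-- boxes: subsets of Q × Q, as Boolean matrices (so ≡ is extensional)
Box : ℕ → Set
Box k = Vec (Vec Bool k) k

_⨾ᵇ_ : ∀ {k} → Box k → Box k → Box k
ρ ⨾ᵇ τ = tabulate λ q → tabulate λ q'' →
           anyFin λ q' → lookup (lookup ρ q) q' ∧ lookup (lookup τ q') q''

idBox : ∀ {k} → Box k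
idBox = tabulate λ q → tabulate λ q' → does (q ≟ q')

letterBox : ∀ {nT} (A : NFA nT) → Fin nT → Box (NFA.nQ A)
letterBox A a = tabulate λ q → tabulate λ q' → NFA.trans A q a q'

data Formula (k : ℕ) : Set where
  atom  : Box k → Formula k
  _∧ᶠ_  : Formula k → Formula k → Formula k
  _∨ᶠ_  : Formula k → Formula k → Formula k
  false : Formula k

module _ {k : ℕ} where
  _∧ˢ_ : Formula k → Formula k → Formula k
  false ∧ˢ G = false
  atom ρ   ∧ˢ false = false
  (F ∧ᶠ F') ∧ˢ false = false
  (F ∨ᶠ F') ∧ˢ false = false
  atom ρ   ∧ˢ G = atom ρ ∧ᶠ G
  (F ∧ᶠ F') ∧ˢ G = (F ∧ᶠ F') ∧ᶠ G
  (F ∨ᶠ F') ∧ˢ G = (F ∨ᶠ F') ∧ᶠ G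

  _∨ˢ_ : Formula k → Formula k → Formula k
  false ∨ˢ G = G
  atom ρ   ∨ˢ false = atom ρ
  (F ∧ᶠ F') ∨ˢ false = F ∧ᶠ F'
  (F ∨ᶠ F') ∨ˢ false = F ∨ᶠ F'
  atom ρ   ∨ˢ G = atom ρ ∨ᶠ G
  (F ∧ᶠ F') ∨ˢ G = (F ∧ᶠ F') ∨ᶠ G
  (F ∨ᶠ F') ∨ˢ G = (F ∨ᶠ F') ∨ᶠ G

  _⨾_ : Formula k → Formula k → Formula k
  false ⨾ G = false
  (F₁ ∧ᶠ F₂) ⨾ G = (F₁ ⨾ G) ∧ˢ (F₂ ⨾ G)
  (F₁ ∨ᶠ F₂) ⨾ G = (F₁ ⨾ G) ∨ˢ (F₂ ⨾ G)
  atom ρ ⨾ false = false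
  atom ρ ⨾ atom τ = atom (ρ ⨾ᵇ τ)
  atom ρ ⨾ (G₁ ∧ᶠ G₂) = (atom ρ ⨾ G₁) ∧ˢ (atom ρ ⨾ G₂)
  atom ρ ⨾ (G₁ ∨ᶠ G₂) = (atom ρ ⨾ G₁) ∨ˢ (atom ρ ⨾ G₂)

  eval : (Box k → Bool) → Formula k → Bool
  eval v (atom ρ) = v ρ
  eval v (F ∧ᶠ G) = eval v F ∧ eval v G
  eval v (F ∨ᶠ G) = eval v F ∨ eval v G
  eval v false    = false

  _≈_ : Formula k → Formula k → Set
  F ≈ G = ∀ v → eval v F ≡ eval v G

  bigAnd : List (Formula k) → Formula k
  bigAnd []       = false   -- never used: every non-terminal has a rule
  bigAnd (F ∷ []) = F
  bigAnd (F ∷ Fs@(_ ∷ _)) = F ∧ˢ bigAnd Fs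

  bigOr : List (Formula k) → Formula k
  bigOr []       = false
  bigOr (F ∷ []) = F
  bigOr (F ∷ Fs@(_ ∷ _)) = F ∨ˢ bigOr Fs

module _ (G : Grammar) (A : NFA (Grammar.nT G)) where
  open Grammar G
  private k = NFA.nQ A

  Assignment : Set
  Assignment = Fin nN → Formula k

  symVal : Assignment → Symbol nN nT → Formula k
  symVal σ (inj₁ a) = atom (letterBox A a)
  symVal σ (inj₂ Y) = σ Y

  ext : Assignment → SF G → Formula k
  ext σ []       = atom idBox
  ext σ (s ∷ []) = symVal σ s
  ext σ (s ∷ η@(_ ∷ _)) = symVal σ s ⨾ ext σ η

  rhsOf : Fin nN → List (SF G)
  rhsOf X = map proj₂ (filter (λ r → proj₁ r ≟ X) rules)

  step : Assignment → Assignment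
  step σ X with owner X
  ... | prover  = bigAnd (map (ext σ) (rhsOf X))
  ... | refuter = bigOr  (map (ext σ) (rhsOf X))

  kleene : ℕ → Assignment
  kleene zero    = λ _ → false
  kleene (suc i) = step (kleene i)

  -- "σ(α) ≈ false" for the least solution σ = lim σⁱ: the (eventually
  -- constant) sequence σⁱ(α) has limit equivalent to false
  LeastSolutionFalseAt : SF G → Set
  LeastSolutionFalseAt α = ∃ λ N → ∀ i → N ≤ i → ext (kleene i) α ≈ false

module Submission where

-- A negation-free formula is ≈ false iff it is false when every box is read
-- as true (its truth).  Under this reading composition is conjunction, so the
-- truths of the Kleene iterates σⁱ follow a Boolean version of the equation
-- system (module Abstraction): a prover non-terminal needs all of its
-- right-hand sides true, a refuter non-terminal one of them.  These Boolean
-- approximants form an ascending chain of subsets of the non-terminals, so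
-- they reach a plateau, the valuation limit, closed under the Boolean step.
--   (⇒, RefuterAttack) by induction on i: if the i-th approximant of α is
--       true, refuter drives any prover strategy into a terminal word.
--   (⇐, ProverDefence) if σⁱ(α) ≈ false for large i, α is false under limit,
--       and prover keeps the current form false by expanding with a false
--       right-hand side; terminal words are true, so no play ends.

open import Defs
open import Data.Nat using (ℕ; zero; suc; _<_; _≤_; _+_; z≤n; s≤s)
open import Data.Nat.Properties using (≤-refl; ≤-trans; n≮n; m≤m+n; n≤1+n)
open import Data.Bool using (Bool; true; false; _∧_; _∨_)
open import Data.Bool.Properties
  using (∧-zeroʳ; ∧-identityʳ; ∧-assoc; ∨-zeroʳ; ∨-identityʳ; ∧-distribʳ-∨)
  renaming (_≟_ to _≟ᵇ_)
open import Data.Fin using (Fin; _≟_)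
open import Data.Fin.Properties using (all?; ¬∀⟶∃¬)
open import Data.Fin.Subset using (∣_∣) renaming (_∈_ to _∈ˢ_)
open import Data.Fin.Subset.Properties using (p⊂q⇒∣p∣<∣q∣; ∣p∣≤n)
open import Data.Vec using (tabulate)
open import Data.Vec.Properties using (lookup∘tabulate; []=⇒lookup; lookup⇒[]=)
open import Data.List using (List; []; _∷_; _++_; _∷ʳ_; map; upTo)
open import Data.List.Properties
  using (map-∘; map-cong; map-++; ++-assoc; ++-identityʳ; ∷-injective; map-applyUpTo)
open import Data.List.Membership.Propositional using (_∈_; find)
open import Data.List.Membership.Propositional.Properties using (∈-map∘filter⁺; ∈-map∘filter⁻)
open import Data.List.Relation.Unary.Any using (here; there)
open import Data.List.Relation.Unary.All using ([]; _∷_)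
open import Data.Product using (_×_; _,_; proj₁; proj₂; ∃; ∃₂)
open import Data.Sum using (_⊎_; inj₁; inj₂; [_,_]′)
open import Data.Sum.Properties using (inj₁-injective)
open import Data.Empty using (⊥; ⊥-elim)
open import Data.Unit using (tt)
open import Function.Base using (_∘_)
open import Function.Bundles using (_⇔_; mk⇔)
open import Relation.Nullary using (yes; no; contradiction)
open import Relation.Binary.PropositionalEquality

_⊑_ : ∀ {a} {A : Set a} → (A → Bool) → (A → Bool) → Set a
p ⊑ q = ∀ x → p x ≡ true → q x ≡ true

⊑-false : ∀ {a} {A : Set a} {p q : A → Bool} → p ⊑ q → ∀ x → q x ≡ false → p x ≡ false
⊑-false {p = p} p⊑q x qx with p x in px
... | false = refl
... | true  = trans (sym (p⊑q x px)) qx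

∧-true : ∀ {a b} → a ∧ b ≡ true → a ≡ true × b ≡ true
∧-true {true} {true} refl = refl , refl

∧-false : ∀ {a b} → a ∧ b ≡ false → a ≡ false ⊎ b ≡ false
∧-false {false} _ = inj₁ refl
∧-false {true}  e = inj₂ e

∨-true : ∀ {a b} → a ∨ b ≡ true → a ≡ true ⊎ b ≡ true
∨-true {true}  _ = inj₁ refl
∨-true {false} e = inj₂ e

∨-false : ∀ {a b} → a ∨ b ≡ false → a ≡ false × b ≡ false
∨-false {false} {false} refl = refl , refl

new-element : ∀ {a c} → (a ≡ true → c ≡ true) → c ≢ a → a ≡ false × c ≡ true
new-element {false} {false} _  changed = contradiction refl changed
new-element {false} {true}  _  _       = refl , refl
new-element {true}          up changed = contradiction (up refl) changed

∧-distribʳ-∧ : ∀ a b c → (a ∧ c) ∧ (b ∧ c) ≡ (a ∧ b) ∧ c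
∧-distribʳ-∧ false b c     = refl
∧-distribʳ-∧ true  b false = sym (∧-zeroʳ b)
∧-distribʳ-∧ true  b true  = refl

-- The truth of a formula decides equivalence to false.

module _ {k : ℕ} where

  -- Read every box as true.  For negation-free formulas this is the
  -- largest valuation, so F ≈ false iff truth F ≡ false.
  truth : Formula k → Bool
  truth = eval (λ _ → true)

  ∧ˢ-sound : ∀ v (F G : Formula k) → eval v (F ∧ˢ G) ≡ eval v F ∧ eval v G
  ∧ˢ-sound v false      G          = refl
  ∧ˢ-sound v (atom _)   false      = sym (∧-zeroʳ _)
  ∧ˢ-sound v (F ∧ᶠ F')  false      = sym (∧-zeroʳ _)
  ∧ˢ-sound v (F ∨ᶠ F')  false      = sym (∧-zeroʳ _)
  ∧ˢ-sound v (atom _)   (atom _)   = refl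
  ∧ˢ-sound v (atom _)   (_ ∧ᶠ _)   = refl
  ∧ˢ-sound v (atom _)   (_ ∨ᶠ _)   = refl
  ∧ˢ-sound v (F ∧ᶠ F')  (atom _)   = refl
  ∧ˢ-sound v (F ∧ᶠ F')  (_ ∧ᶠ _)   = refl
  ∧ˢ-sound v (F ∧ᶠ F')  (_ ∨ᶠ _)   = refl
  ∧ˢ-sound v (F ∨ᶠ F')  (atom _)   = refl
  ∧ˢ-sound v (F ∨ᶠ F')  (_ ∧ᶠ _)   = refl
  ∧ˢ-sound v (F ∨ᶠ F')  (_ ∨ᶠ _)   = refl

  ∨ˢ-sound : ∀ v (F G : Formula k) → eval v (F ∨ˢ G) ≡ eval v F ∨ eval v G
  ∨ˢ-sound v false      G          = refl
  ∨ˢ-sound v (atom _)   false      = sym (∨-identityʳ _)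
  ∨ˢ-sound v (F ∧ᶠ F')  false      = sym (∨-identityʳ _)
  ∨ˢ-sound v (F ∨ᶠ F')  false      = sym (∨-identityʳ _)
  ∨ˢ-sound v (atom _)   (atom _)   = refl
  ∨ˢ-sound v (atom _)   (_ ∧ᶠ _)   = refl
  ∨ˢ-sound v (atom _)   (_ ∨ᶠ _)   = refl
  ∨ˢ-sound v (F ∧ᶠ F')  (atom _)   = refl
  ∨ˢ-sound v (F ∧ᶠ F')  (_ ∧ᶠ _)   = refl
  ∨ˢ-sound v (F ∧ᶠ F')  (_ ∨ᶠ _)   = refl
  ∨ˢ-sound v (F ∨ᶠ F')  (atom _)   = refl
  ∨ˢ-sound v (F ∨ᶠ F')  (_ ∧ᶠ _)   = refl
  ∨ˢ-sound v (F ∨ᶠ F')  (_ ∨ᶠ _)   = refl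

  truth-⨾ : ∀ (F G : Formula k) → truth (F ⨾ G) ≡ truth F ∧ truth G
  truth-⨾ false G = refl
  truth-⨾ (F₁ ∧ᶠ F₂) G = begin
    truth ((F₁ ⨾ G) ∧ˢ (F₂ ⨾ G))           ≡⟨ ∧ˢ-sound _ (F₁ ⨾ G) (F₂ ⨾ G) ⟩
    truth (F₁ ⨾ G) ∧ truth (F₂ ⨾ G)         ≡⟨ cong₂ _∧_ (truth-⨾ F₁ G) (truth-⨾ F₂ G) ⟩
    (truth F₁ ∧ truth G) ∧ (truth F₂ ∧ truth G) ≡⟨ ∧-distribʳ-∧ (truth F₁) (truth F₂) (truth G) ⟩
    (truth F₁ ∧ truth F₂) ∧ truth G         ∎
    where open ≡-Reasoning
  truth-⨾ (F₁ ∨ᶠ F₂) G = begin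
    truth ((F₁ ⨾ G) ∨ˢ (F₂ ⨾ G))           ≡⟨ ∨ˢ-sound _ (F₁ ⨾ G) (F₂ ⨾ G) ⟩
    truth (F₁ ⨾ G) ∨ truth (F₂ ⨾ G)         ≡⟨ cong₂ _∨_ (truth-⨾ F₁ G) (truth-⨾ F₂ G) ⟩
    (truth F₁ ∧ truth G) ∨ (truth F₂ ∧ truth G) ≡⟨ sym (∧-distribʳ-∨ (truth G) (truth F₁) (truth F₂)) ⟩
    (truth F₁ ∨ truth F₂) ∧ truth G         ∎
    where open ≡-Reasoning
  truth-⨾ (atom ρ) false      = refl
  truth-⨾ (atom ρ) (atom τ)   = refl
  truth-⨾ (atom ρ) (G₁ ∧ᶠ G₂) = trans (∧ˢ-sound _ (atom ρ ⨾ G₁) (atom ρ ⨾ G₂))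
                                      (cong₂ _∧_ (truth-⨾ (atom ρ) G₁) (truth-⨾ (atom ρ) G₂))
  truth-⨾ (atom ρ) (G₁ ∨ᶠ G₂) = trans (∨ˢ-sound _ (atom ρ ⨾ G₁) (atom ρ ⨾ G₂))
                                      (cong₂ _∨_ (truth-⨾ (atom ρ) G₁) (truth-⨾ (atom ρ) G₂))

  -- Negation-free formulas are monotone: truth dominates every valuation.
  eval⇒truth : ∀ v (F : Formula k) → eval v F ≡ true → truth F ≡ true
  eval⇒truth v (atom ρ) _ = refl
  eval⇒truth v (F ∧ᶠ G) e =
    let eF , eG = ∧-true e in cong₂ _∧_ (eval⇒truth v F eF) (eval⇒truth v G eG)
  eval⇒truth v (F ∨ᶠ G) e with ∨-true e
  ... | inj₁ eF = cong (_∨ truth G) (eval⇒truth v F eF)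
  ... | inj₂ eG = trans (cong (truth F ∨_) (eval⇒truth v G eG)) (∨-zeroʳ (truth F))
  eval⇒truth v false ()

  truth-false⇒≈false : (F : Formula k) → truth F ≡ false → F ≈ false
  truth-false⇒≈false F tF v with eval v F in e
  ... | false = refl
  ... | true  = trans (sym (eval⇒truth v F e)) tF

-- Boolean shadows of bigAnd and bigOr (with the same value on []).
conj : List Bool → Bool
conj []                = false
conj (b ∷ [])          = b
conj (b ∷ bs@(_ ∷ _))  = b ∧ conj bs

disj : List Bool → Bool
disj []                = false
disj (b ∷ [])          = b
disj (b ∷ bs@(_ ∷ _))  = b ∨ disj bs

module _ {k : ℕ} where

  truth-bigAnd : (Fs : List (Formula k)) → truth (bigAnd Fs) ≡ conj (map truth Fs)
  truth-bigAnd []                = refl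
  truth-bigAnd (F ∷ [])          = refl
  truth-bigAnd (F ∷ Fs@(_ ∷ _))  =
    trans (∧ˢ-sound _ F (bigAnd Fs)) (cong (truth F ∧_) (truth-bigAnd Fs))

  truth-bigOr : (Fs : List (Formula k)) → truth (bigOr Fs) ≡ disj (map truth Fs)
  truth-bigOr []                = refl
  truth-bigOr (F ∷ [])          = refl
  truth-bigOr (F ∷ Fs@(_ ∷ _))  =
    trans (∨ˢ-sound _ F (bigOr Fs)) (cong (truth F ∨_) (truth-bigOr Fs))

module _ {a} {A : Set a} (f : A → Bool) where

  conj-true : ∀ xs → conj (map f xs) ≡ true → ∀ {x} → x ∈ xs → f x ≡ true
  conj-true (x ∷ [])           e (here refl) = e
  conj-true (x ∷ xs@(_ ∷ _))   e (here refl) = proj₁ (∧-true e)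
  conj-true (x ∷ xs@(_ ∷ _))   e (there x∈)  = conj-true xs (proj₂ (∧-true {f x} e)) x∈

  -- In a nonempty list there is an element that is false whenever the
  -- conjunction is: the first false one, if any.
  conj-falsifier : ∀ {xs y} → y ∈ xs →
                   ∃ λ x → x ∈ xs × (conj (map f xs) ≡ false → f x ≡ false)
  conj-falsifier {x ∷ []}           _ = x , here refl , λ e → e
  conj-falsifier {x ∷ xs@(_ ∷ _)}   _ with conj-falsifier {xs} (here refl) | f x in fx
  ... | _            | false = x , here refl , λ _ → fx
  ... | z , z∈ , hz  | true  = z , there z∈ , hz

  disj-true : ∀ xs → disj (map f xs) ≡ true → ∃ λ x → x ∈ xs × f x ≡ true
  disj-true (x ∷ [])           e = x , here refl , e
  disj-true (x ∷ xs@(_ ∷ _))   e =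
    [ (λ fx → x , here refl , fx)
    , (λ rest → let z , z∈ , fz = disj-true xs rest in z , there z∈ , fz)
    ]′ (∨-true {f x} e)

  disj-false : ∀ xs → disj (map f xs) ≡ false → ∀ {x} → x ∈ xs → f x ≡ false
  disj-false (x ∷ [])           e (here refl) = e
  disj-false (x ∷ xs@(_ ∷ _))   e (here refl) = proj₁ (∨-false e)
  disj-false (x ∷ xs@(_ ∷ _))   e (there x∈)  = disj-false xs (proj₂ (∨-false {f x} e)) x∈

module _ {a} {A : Set a} {f g : A → Bool} (f⊑g : f ⊑ g) where

  conj-mono : ∀ xs → conj (map f xs) ≡ true → conj (map g xs) ≡ true
  conj-mono (x ∷ [])           e = f⊑g x e
  conj-mono (x ∷ xs@(_ ∷ _))   e =
    let fx , rest = ∧-true e in cong₂ _∧_ (f⊑g x fx) (conj-mono xs rest)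

  disj-mono : ∀ xs → disj (map f xs) ≡ true → disj (map g xs) ≡ true
  disj-mono (x ∷ [])           e = f⊑g x e
  disj-mono (x ∷ xs@(_ ∷ _))   e =
    [ (λ fx → cong (_∨ disj (map g xs)) (f⊑g x fx))
    , (λ rest → trans (cong (g x ∨_) (disj-mono xs rest)) (∨-zeroʳ (g x)))
    ]′ (∨-true {f x} e)

-- Ascending chains of subsets of a finite set stop growing.

module _ {n : ℕ} where

  -- A Boolean predicate on Fin n as a subset, to measure its size.
  ∈-tabulate⁺ : ∀ (p : Fin n → Bool) {x} → p x ≡ true → x ∈ˢ tabulate p
  ∈-tabulate⁺ p {x} px = lookup⇒[]= x (tabulate p) (trans (lookup∘tabulate p x) px)

  ∈-tabulate⁻ : ∀ (p : Fin n → Bool) {x} → x ∈ˢ tabulate p → p x ≡ true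
  ∈-tabulate⁻ p {x} x∈p = trans (sym (lookup∘tabulate p x)) ([]=⇒lookup x∈p)

  size-grows : ∀ {p q : Fin n → Bool} → p ⊑ q → ∀ x → p x ≡ false → q x ≡ true →
               ∣ tabulate p ∣ < ∣ tabulate q ∣
  size-grows {p} {q} p⊑q x px qx = p⊂q⇒∣p∣<∣q∣ (inclusion , x , ∈-tabulate⁺ q qx , x∉p)
    where
      inclusion : ∀ {y} → y ∈ˢ tabulate p → y ∈ˢ tabulate q
      inclusion {y} y∈p = ∈-tabulate⁺ q (p⊑q y (∈-tabulate⁻ p y∈p))
      x∉p : x ∈ˢ tabulate p → ⊥
      x∉p x∈p = contradiction (trans (sym (∈-tabulate⁻ p x∈p)) px) λ ()

module AscendingChain {n : ℕ} (b : ℕ → Fin n → Bool) (ascending : ∀ i → b i ⊑ b (suc i)) where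

  Plateau : Set
  Plateau = ∃ λ i → b (suc i) ⊑ b i

  plateau-or-growth : ∀ i → Plateau ⊎ i ≤ ∣ tabulate (b i) ∣
  plateau-or-growth zero = inj₂ z≤n
  plateau-or-growth (suc i) with plateau-or-growth i
  ... | inj₁ found = inj₁ found
  ... | inj₂ grown with all? (λ x → b (suc i) x ≟ᵇ b i x)
  ...   | yes same = inj₁ (i , λ x e → trans (sym (same x)) e)
  ...   | no differ =
    let x , changed = ¬∀⟶∃¬ n _ (λ x → b (suc i) x ≟ᵇ b i x) differ
        old , new   = new-element (ascending i x) changed
    in inj₂ (≤-trans (s≤s grown) (size-grows (ascending i) x old new))

  -- Hence a plateau occurs: the (n+1)-th member cannot have n+1 elements.
  plateau : Plateau
  plateau with plateau-or-growth (suc n)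
  ... | inj₁ found = found
  ... | inj₂ big   = ⊥-elim (n≮n n (≤-trans big (∣p∣≤n (tabulate (b (suc n))))))

-- The Boolean abstraction of the equation system and its limit.

module Abstraction (G : Grammar) (A : NFA (Grammar.nT G)) where
  open Grammar G

  rhs : Fin nN → List (SF G)
  rhs = rhsOf G A

  rule⇒rhs : ∀ {X η} → (X , η) ∈ rules → η ∈ rhs X
  rule⇒rhs {X} m = ∈-map∘filter⁺ proj₂ (λ r → proj₁ r ≟ X) (_ , m , refl , refl)

  rhs⇒rule : ∀ {X η} → η ∈ rhs X → (X , η) ∈ rules
  rhs⇒rule {X} m with ∈-map∘filter⁻ proj₂ (λ r → proj₁ r ≟ X) m
  ... | _ , m' , refl , refl = m'

  some-rhs : ∀ X → ∃ λ η → η ∈ rhs X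
  some-rhs X with find (total X)
  ... | (_ , η) , m , refl = η , rule⇒rhs m

  -- Truth of a sentential form when non-terminal Y has truth b Y.
  holds : (Fin nN → Bool) → SF G → Bool
  holds b []           = true
  holds b (inj₁ a ∷ η) = holds b η
  holds b (inj₂ Y ∷ η) = b Y ∧ holds b η

  combine : Owner → List Bool → Bool
  combine prover  = conj
  combine refuter = disj

  abstractStep : (Fin nN → Bool) → (Fin nN → Bool)
  abstractStep b X = combine (owner X) (map (holds b) (rhs X))

  abstractStep-owner : ∀ b X {o} → owner X ≡ o → abstractStep b X ≡ combine o (map (holds b) (rhs X))
  abstractStep-owner b X eo = cong (λ o → combine o (map (holds b) (rhs X))) eo

  truth-ext : (σ : Assignment G A) (η : SF G) → truth (ext G A σ η) ≡ holds (truth ∘ σ) η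
  truth-ext σ []                      = refl
  truth-ext σ (inj₁ a ∷ [])           = refl
  truth-ext σ (inj₂ Y ∷ [])           = sym (∧-identityʳ _)
  truth-ext σ (inj₁ a ∷ η@(_ ∷ _))    = trans (truth-⨾ (atom _) (ext G A σ η)) (truth-ext σ η)
  truth-ext σ (inj₂ Y ∷ η@(_ ∷ _))    =
    trans (truth-⨾ (σ Y) (ext G A σ η)) (cong (truth (σ Y) ∧_) (truth-ext σ η))

  truths-ext : (σ : Assignment G A) (ηs : List (SF G)) →
               map truth (map (ext G A σ) ηs) ≡ map (holds (truth ∘ σ)) ηs
  truths-ext σ ηs = trans (sym (map-∘ ηs)) (map-cong (truth-ext σ) ηs)

  truth-step : (σ : Assignment G A) (X : Fin nN) → truth (step G A σ X) ≡ abstractStep (truth ∘ σ) X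
  truth-step σ X with owner X
  ... | prover  = trans (truth-bigAnd (map (ext G A σ) (rhs X))) (cong conj (truths-ext σ (rhs X)))
  ... | refuter = trans (truth-bigOr  (map (ext G A σ) (rhs X))) (cong disj (truths-ext σ (rhs X)))

  holds-mono : ∀ {b b'} → b ⊑ b' → holds b ⊑ holds b'
  holds-mono b⊑b' []           e = refl
  holds-mono b⊑b' (inj₁ a ∷ η) e = holds-mono b⊑b' η e
  holds-mono b⊑b' (inj₂ Y ∷ η) e =
    let eY , eη = ∧-true e in cong₂ _∧_ (b⊑b' Y eY) (holds-mono b⊑b' η eη)

  holds-++ : ∀ b (η γ : SF G) → holds b (η ++ γ) ≡ holds b η ∧ holds b γ
  holds-++ b []           γ = refl
  holds-++ b (inj₁ a ∷ η) γ = holds-++ b η γ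
  holds-++ b (inj₂ Y ∷ η) γ = trans (cong (b Y ∧_) (holds-++ b η γ)) (sym (∧-assoc (b Y) _ _))

  holds-frame : ∀ b w (η γ : SF G) → holds b (map inj₁ w ++ η ++ γ) ≡ holds b η ∧ holds b γ
  holds-frame b []      η γ = holds-++ b η γ
  holds-frame b (a ∷ w) η γ = holds-frame b w η γ

  holds-leftmost : ∀ b w X (γ : SF G) → holds b (map inj₁ w ++ inj₂ X ∷ γ) ≡ b X ∧ holds b γ
  holds-leftmost b []      X γ = refl
  holds-leftmost b (a ∷ w) X γ = holds-leftmost b w X γ

  holds-terminal : ∀ b {p} → IsTerminalWord G p → holds b p ≡ true
  holds-terminal b []                      = refl
  holds-terminal b {inj₁ a ∷ p} (_ ∷ rest) = holds-terminal b rest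

  combine-mono : ∀ o {f g : SF G → Bool} → f ⊑ g →
                 ∀ ηs → combine o (map f ηs) ≡ true → combine o (map g ηs) ≡ true
  combine-mono prover  f⊑g = conj-mono f⊑g
  combine-mono refuter f⊑g = disj-mono f⊑g

  abstractStep-mono : ∀ {b b'} → b ⊑ b' → abstractStep b ⊑ abstractStep b'
  abstractStep-mono b⊑b' X = combine-mono (owner X) (holds-mono b⊑b') (rhs X)

  approx : ℕ → Fin nN → Bool
  approx i X = truth (kleene G A i X)

  approx-suc : ∀ i X → approx (suc i) X ≡ abstractStep (approx i) X
  approx-suc i = truth-step (kleene G A i)

  approx-ascending : ∀ i → approx i ⊑ approx (suc i)
  approx-ascending zero    X ()
  approx-ascending (suc i) X e =
    trans (approx-suc (suc i) X)
          (abstractStep-mono (approx-ascending i) X (trans (sym (approx-suc i X)) e))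

  approx-ascending⁺ : ∀ k i → approx i ⊑ approx (k + i)
  approx-ascending⁺ zero    i X e = e
  approx-ascending⁺ (suc k) i X e = approx-ascending (k + i) X (approx-ascending⁺ k i X e)

  open AscendingChain approx approx-ascending using (plateau)

  stage : ℕ
  stage = proj₁ plateau

  limit : Fin nN → Bool
  limit = approx stage

  limit-closed : abstractStep limit ⊑ limit
  limit-closed X e = proj₂ plateau X (trans (approx-suc stage X) e)

-- Left derivation steps act on the leftmost non-terminal.

module Leftmost (G : Grammar) where
  open Grammar G

  data Split : SF G → Set where
    leftmost : ∀ w X γ → Split (map inj₁ w ++ inj₂ X ∷ γ)
    terminal : ∀ {p} → IsTerminalWord G p → Split p

  split : ∀ p → Split p
  split []           = terminal []
  split (inj₂ X ∷ p) = leftmost [] X p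
  split (inj₁ a ∷ p) with split p
  ... | leftmost w X γ = leftmost (a ∷ w) X γ
  ... | terminal t     = terminal (tt ∷ t)

  ownerOf-leftmost : ∀ w X γ → ownerOf G (map inj₁ w ++ inj₂ X ∷ γ) ≡ owner X
  ownerOf-leftmost []      X γ = refl
  ownerOf-leftmost (a ∷ w) X γ = ownerOf-leftmost w X γ

  ownerOf-terminal : ∀ {p} → IsTerminalWord G p → ownerOf G p ≡ refuter
  ownerOf-terminal []                      = refl
  ownerOf-terminal {inj₁ a ∷ p} (_ ∷ rest) = ownerOf-terminal rest

  leftmost-unique : ∀ w w' X X' (γ γ' : SF G) →
                    map inj₁ w ++ inj₂ X ∷ γ ≡ map inj₁ w' ++ inj₂ X' ∷ γ' →
                    w ≡ w' × X ≡ X' × γ ≡ γ'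
  leftmost-unique []      []       X X' γ γ' refl = refl , refl , refl
  leftmost-unique (a ∷ w) (a' ∷ w') X X' γ γ' e with ∷-injective e
  ... | ea , rest with leftmost-unique w w' X X' γ γ' rest
  ...   | refl , refl , refl = cong (_∷ w) (inj₁-injective ea) , refl , refl

  step-inversion : ∀ {q} w X γ → _⇒L_ G (map inj₁ w ++ inj₂ X ∷ γ) q →
                   ∃ λ η → (X , η) ∈ rules × q ≡ map inj₁ w ++ η ++ γ
  step-inversion w X γ step = invert step refl
    where
      invert : ∀ {p q} → _⇒L_ G p q → p ≡ map inj₁ w ++ inj₂ X ∷ γ →
               ∃ λ η → (X , η) ∈ rules × q ≡ map inj₁ w ++ η ++ γ
      invert (leftStep w' X' η γ' m) e with leftmost-unique w' w X' X γ' γ e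
      ... | refl , refl , refl = η , m , refl

-- If some approximant of α is true, refuter defeats every prover strategy

module RefuterAttack (G : Grammar) (A : NFA (Grammar.nT G)) (s : ProverStrategy G) where
  open Grammar G
  open Leftmost G
  open Abstraction G A

  -- A finite stretch of play conforming to s, from position p with history h
  -- to position q with history h'.
  data Run : List (SF G) → SF G → List (SF G) → SF G → Set where
    stop : ∀ {h p} → Run h p h p
    next : ∀ {h p p' h' q} → _⇒L_ G p p' → (ownerOf G p ≡ prover → p' ≡ move s h p) →
           Run (h ∷ʳ p) p' h' q → Run h p h' q

  _▹_ : ∀ {h p h' q h'' r} → Run h p h' q → Run h' q h'' r → Run h p h'' r
  stop          ▹ r₂ = r₂
  next st c r₁  ▹ r₂ = next st c (r₁ ▹ r₂)

  -- Refuter can make the play from p, with history h, reach w w' γ for some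
  -- terminal word w': the part before γ is completely derived.
  Reaches : List (SF G) → SF G → List (Fin nT) → SF G → Set
  Reaches h p w γ = ∃₂ λ h' w' → Run h p h' (map inj₁ (w ++ w') ++ γ)

  run-cong : ∀ {h p p' h' q q'} → p ≡ p' → q ≡ q' → Run h p h' q → Run h p' h' q'
  run-cong {h} {h' = h'} = subst₂ (λ x y → Run h x h' y)

  shift-letter : ∀ w a (rest : SF G) → map inj₁ (w ∷ʳ a) ++ rest ≡ map inj₁ w ++ inj₁ a ∷ rest
  shift-letter w a rest = trans (cong (_++ rest) (map-++ inj₁ w (a ∷ []))) (++-assoc (map inj₁ w) _ rest)

  -- By induction on i: if the i-th approximant of X (of η) is true, refuter
  -- forces a complete derivation of X (of η), whatever prover does.
  force-nonterminal : ∀ i X → approx i X ≡ true →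
                      ∀ w γ h → Reaches h (map inj₁ w ++ inj₂ X ∷ γ) w γ
  force-form        : ∀ i η → holds (approx i) η ≡ true →
                      ∀ w γ h → Reaches h (map inj₁ w ++ η ++ γ) w γ

  force-nonterminal zero X () w γ h
  force-nonterminal (suc i) X e w γ h
    with owner X in eo | trans (sym (approx-suc i X)) e
  ... | prover | all-true =
    let p                 = map inj₁ w ++ inj₂ X ∷ γ
        st                = legal s h p (trans (ownerOf-leftmost w X γ) eo)
        η , rule , chosen = step-inversion w X γ st
        holds-η           = conj-true _ (rhs X) all-true (rule⇒rhs rule)
        h' , w' , r       = force-form i η holds-η w γ (h ∷ʳ p)
    in h' , w' , next st (λ _ → refl) (run-cong (sym chosen) refl r)
  ... | refuter | some-true =
    let η , η∈ , holds-η = disj-true _ (rhs X) some-true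
        h' , w' , r      = force-form i η holds-η w γ (h ∷ʳ _)
        not-prover       = λ op → contradiction (trans (sym op) (trans (ownerOf-leftmost w X γ) eo))
                                                λ ()
    in h' , w' , next (leftStep w X η γ (rhs⇒rule η∈)) not-prover r

  force-form i [] e w γ h =
    h , [] , run-cong refl (cong (λ v → map inj₁ v ++ γ) (sym (++-identityʳ w))) stop
  force-form i (inj₁ a ∷ η) e w γ h =
    let h' , w' , r = force-form i η e (w ∷ʳ a) γ h
    in h' , a ∷ w' , run-cong (shift-letter w a (η ++ γ))
                              (cong (λ v → map inj₁ v ++ γ) (++-assoc w (a ∷ []) w')) r
  force-form i (inj₂ X ∷ η) e w γ h =
    let eX , eη          = ∧-true e
        h₁ , w₁ , r₁     = force-nonterminal i X eX w (η ++ γ) h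
        h₂ , w₂ , r₂     = force-form i η eη (w ++ w₁) γ h₁
    in h₂ , w₁ ++ w₂ , run-cong refl (cong (λ v → map inj₁ v ++ γ) (++-assoc w w₁ w₂)) (r₁ ▹ r₂)

  len : ∀ {h p h' q} → Run h p h' q → ℕ
  len stop         = 0
  len (next _ _ r) = suc (len r)

  position : ∀ {h p h' q} → Run h p h' q → ℕ → SF G
  position {p = p} stop         _       = p
  position {p = p} (next _ _ r) zero    = p
  position         (next _ _ r) (suc i) = position r i

  position-start : ∀ {h p h' q} (r : Run h p h' q) → position r 0 ≡ p
  position-start stop         = refl
  position-start (next _ _ r) = refl

  position-end : ∀ {h p h' q} (r : Run h p h' q) → position r (len r) ≡ q
  position-end stop         = refl
  position-end (next _ _ r) = position-end r

  position-step : ∀ {h p h' q} (r : Run h p h' q) → ∀ i → i < len r →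
                  _⇒L_ G (position r i) (position r (suc i))
  position-step (next st _ r) zero    _         = subst (_⇒L_ G _) (sym (position-start r)) st
  position-step (next _ _ r)  (suc i) (s≤s i<n) = position-step r i i<n

  position-conforms : ∀ {h p h' q} (r : Run h p h' q) → ∀ i → i < len r →
                      ownerOf G (position r i) ≡ prover →
                      position r (suc i) ≡ move s (h ++ map (position r) (upTo i)) (position r i)
  position-conforms {h} {p} (next _ c r) zero _ op =
    trans (position-start r) (trans (c op) (cong (λ h₀ → move s h₀ p) (sym (++-identityʳ h))))
  position-conforms {h} {p} (next st c r) (suc i) (s≤s i<n) op =
    trans (position-conforms r i i<n op) (cong (λ h₀ → move s h₀ (position r i)) history)
    where
      history : (h ∷ʳ p) ++ map (position r) (upTo i) ≡ h ++ map (position (next st c r)) (upTo (suc i))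
      history = trans (++-assoc h (p ∷ []) _)
                      (cong (λ z → h ++ p ∷ z)
                            (trans (map-applyUpTo (λ j → j) (position r) i)
                                   (sym (map-applyUpTo suc (position (next st c r)) i))))

  -- A run from the start that ends in a terminal word is a finite maximal
  -- play conforming to s, which a winning strategy does not allow.
  no-finished-run : ∀ {α h' q} → IsWinningFrom G s α → Run [] α h' q → IsTerminalWord G q → ⊥
  no-finished-run win r done =
    win (finitePlay (len r) (position r))
        (position-start r , position-step r , subst (IsTerminalWord G) (sym (position-end r)) done)
        (position-conforms r)

  terminal-word : ∀ w → IsTerminalWord G (map inj₁ w ++ [])
  terminal-word []      = []
  terminal-word (a ∷ w) = tt ∷ terminal-word w

  approx-false : ∀ {α} → IsWinningFrom G s α → ∀ i → holds (approx i) α ≡ false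
  approx-false {α} win i with holds (approx i) α in e
  ... | false = refl
  ... | true  =
    let h' , w' , r = force-form i α e [] [] []
    in ⊥-elim (no-finished-run win (run-cong (++-identityʳ α) refl r) (terminal-word w'))

-- If the limit valuation makes α false, prover wins by keeping it false

module ProverDefence (G : Grammar) (A : NFA (Grammar.nT G)) where
  open Grammar G
  open Leftmost G
  open Abstraction G A

  -- The invariant prover maintains.
  Safe : SF G → Set
  Safe p = holds limit p ≡ false

  -- For each non-terminal a rule that stays false under limit whenever
  -- possible; for a false prover non-terminal it is always possible.
  choice : ∀ X → ∃ λ η → (X , η) ∈ rules × (owner X ≡ prover → limit X ≡ false → holds limit η ≡ false)
  choice X =
    let η , η∈ , falsifies = conj-falsifier (holds limit) (proj₂ (some-rhs X))
    in η , rhs⇒rule η∈ ,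
       λ op lX → falsifies (trans (sym (abstractStep-owner limit X op)) (⊑-false limit-closed X lX))

  strategy-move : List (SF G) → SF G → SF G
  strategy-move h p with split p
  ... | leftmost w X γ = map inj₁ w ++ proj₁ (choice X) ++ γ
  ... | terminal _     = p

  strategy-legal : ∀ h p → ownerOf G p ≡ prover → _⇒L_ G p (strategy-move h p)
  strategy-legal h p op with split p
  ... | leftmost w X γ = leftStep w X _ γ (proj₁ (proj₂ (choice X)))
  ... | terminal t     = contradiction (trans (sym op) (ownerOf-terminal t)) λ ()

  strategy : ProverStrategy G
  strategy = record { move = strategy-move ; legal = strategy-legal }

  replace-safe : ∀ w X η γ → (limit X ≡ false → holds limit η ≡ false) →
                 Safe (map inj₁ w ++ inj₂ X ∷ γ) → Safe (map inj₁ w ++ η ++ γ)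
  replace-safe w X η γ X⇒η safe =
    trans (holds-frame limit w η γ)
          ([ (λ lX → cong (_∧ holds limit γ) (X⇒η lX))
           , (λ lγ → trans (cong (holds limit η ∧_) lγ) (∧-zeroʳ _))
           ]′ (∧-false (trans (sym (holds-leftmost limit w X γ)) safe)))

  prover-move-safe : ∀ h p → ownerOf G p ≡ prover → Safe p → Safe (strategy-move h p)
  prover-move-safe h p op safe with split p
  ... | leftmost w X γ =
    replace-safe w X _ γ (proj₂ (proj₂ (choice X)) (trans (sym (ownerOf-leftmost w X γ)) op)) safe
  ... | terminal _     = safe

  -- Every rule of a false refuter non-terminal is false, since limit is closed.
  refuter-move-safe : ∀ {p q} → _⇒L_ G p q → ownerOf G p ≡ refuter → Safe p → Safe q
  refuter-move-safe (leftStep w X η γ m) or safe = replace-safe w X η γ all-false safe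
    where
      all-false : limit X ≡ false → holds limit η ≡ false
      all-false lX = disj-false (holds limit) (rhs X)
        (trans (sym (abstractStep-owner limit X (trans (sym (ownerOf-leftmost w X γ)) or)))
               (⊑-false limit-closed X lX))
        (rule⇒rhs m)

  step-safe : ∀ h p q → _⇒L_ G p q → (ownerOf G p ≡ prover → q ≡ strategy-move h p) → Safe p → Safe q
  step-safe h p q st conforms safe with ownerOf G p in eo
  ... | prover  = subst Safe (sym (conforms refl)) (prover-move-safe h p eo safe)
  ... | refuter = refuter-move-safe st eo safe

  -- Terminal words are true, so a conforming play from a safe form never ends.
  strategy-wins : ∀ {α} → Safe α → IsWinningFrom G strategy α
  strategy-wins safe (infinitePlay f) _                      _        = tt
  strategy-wins safe (finitePlay n f) (start , steps , done) conforms =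
    contradiction (trans (sym (holds-terminal limit done)) (safe-at n ≤-refl)) λ ()
    where
      safe-at : ∀ i → i ≤ n → Safe (f i)
      safe-at zero    _   = subst Safe (sym start) safe
      safe-at (suc i) i<n = step-safe (map f (upTo i)) (f i) (f (suc i)) (steps i i<n) (conforms i i<n)
                                      (safe-at i (≤-trans (n≤1+n i) i<n))

theorem9 : (G : Grammar) (A : NFA (Grammar.nT G)) (α : SF G) →
           ProverWinsFrom G α ⇔ LeastSolutionFalseAt G A α
theorem9 G A α = mk⇔ wins⇒false false⇒wins
  where
    open Abstraction G A

    approx⇒≈false : ∀ i → holds (approx i) α ≡ false → ext G A (kleene G A i) α ≈ false
    approx⇒≈false i e =
      truth-false⇒≈false (ext G A (kleene G A i) α) (trans (truth-ext (kleene G A i) α) e)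

    ≈false⇒approx : ∀ i → ext G A (kleene G A i) α ≈ false → holds (approx i) α ≡ false
    ≈false⇒approx i e = trans (sym (truth-ext (kleene G A i) α)) (e (λ _ → true))

    wins⇒false : ProverWinsFrom G α → LeastSolutionFalseAt G A α
    wins⇒false (s , win) = 0 , λ i _ → approx⇒≈false i (RefuterAttack.approx-false G A s win i)

    -- The limit lies below every later approximant, which is false by hypothesis.
    false⇒wins : LeastSolutionFalseAt G A α → ProverWinsFrom G α
    false⇒wins (N , eventually) =
      ProverDefence.strategy G A , ProverDefence.strategy-wins G A limit-false
      where
        limit-false : holds limit α ≡ false
        limit-false = ⊑-false (holds-mono (approx-ascending⁺ N stage)) α
                              (≈false⇒approx (N + stage) (eventually (N + stage) (m≤m+n N stage)))
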